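{- Let $P$ be a protein tree on a protein set $\mathcal{P}$ with LCA-reconciliation labeling $l_P$ (with respect to some gene tree), let $\mathbb{P}=\{P_1,\dots,P_k\}$ be the set of all inclusion-wise maximum creation-free protein subtrees of $P$, and let $\mathbb{P}_{span}$ be the span partition of $\mathcal{P}$ according to $\mathbb{P}$. If $P$ contains at least one node labeled $Creat$, then there exist two distinct sets $S_u,S_v\in\mathbb{P}_{span}$ such that $P_{|S_u}$, $P_{|S_v}$ and $P_{|S_u\cup S_v}$ are complete subtrees of $P$, and for such sets: (1) $l_P(lca_P(S_u\cup S_v))=Creat$; (2) for every $t\in\{u,v\}$ and every $P_i\in span(S_t)$, $P_{|S_t}=P_{i|S_t}$; (3) $span(S_u)\cap span(S_v)=\emptyset$; (4) $\{P_{i|\mathcal{L}(P_i)-S_u} : P_i\in span(S_u)\}=\{P_{i|\mathcal{L}(P_i)-S_v} : P_i\in span(S_v)\}$.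
   Context: Trees are rooted binary trees with labeled leaves. For a tree $T$, $\mathcal{L}(T)$ is its leaf set, $T[x]$ the complete subtree rooted at node $x$ (a "complete subtree" of $T$ is one of the form $T[x]$), and $lca_T$ the lowest common ancestor. For $L'\subseteq\mathcal{L}(T)$, $T_{|L'}$ is the tree on $L'$ obtained from the subtree of $T$ induced by $L'$ (rooted at $lca_T(L')$) by suppressing all internal nodes of degree 2 other than the root; trees are compared as leaf-labeled trees. A labeled protein tree $P$ has each internal node labeled by $l_P$ with one of $Spec$, $Dup$, $Creat$ (obtained from LCA-reconciliation with a gene tree: with $g$ extended to nodes by $g(x)=lca_G$ of the genes of the leaves below $x$, $l_P(x)=Creat$ iff $g(x)=g(x_l)$ or $g(x)=g(x_r)$). Two proteins $x,y$ are orthologs if $l_P(lca_P(\{x,y\}))\neq Creat$. For $L'\subseteq\mathcal{P}$ in which every pair of distinct proteins are orthologs, $P_{|L'}$ is a creation-free subtree of $P$; it is inclusion-wise maximum if $L'$ is maximal under inclusion among such sets. For $x\in\mathcal{P}$, $span(x)=\{P_i\in\mathbb{P}: x\in\mathcal{L}(P_i)\}$. The span partition $\mathbb{P}_{span}=\{S_1,\dots,S_m\}$ is the partition of $\mathcal{P}$ into classes of proteins having equal $span$; for $S_t\in\mathbb{P}_{span}$, $span(S_t)=span(x)$ for any $x\in S_t$. -}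

module Defs where

open import Data.Nat using (ℕ; _≟_)
open import Data.Bool using (Bool; true; false; _∧_; not)
open import Data.Maybe using (Maybe; just; nothing; _>>=_)
open import Data.List using (List; []; _∷_; _++_; map)
open import Data.List.Membership.Propositional using (_∈_; _∉_)
open import Data.List.Membership.DecPropositional _≟_ using (_∈?_)
open import Data.List.Relation.Binary.Subset.Propositional using (_⊆_)
open import Data.List.Relation.Unary.Unique.Propositional using (Unique)
open import Data.Product using (_×_; ∃; ∃-syntax; Σ)
open import Data.Sum using (_⊎_)
open import Data.Empty using (⊥)
open import Relation.Nullary using (¬_; does)
open import Relation.Binary.PropositionalEquality using (_≡_; _≢_)

-- Rooted (full) binary trees whose leaves are labelled by natural numbers
-- (proteins, resp. genes).
data Tree : Set where
  leaf : ℕ → Tree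
  node : Tree → Tree → Tree

leaves : Tree → List ℕ
leaves (leaf a)   = a ∷ []
leaves (node l r) = leaves l ++ leaves r

-- x ⊑ T : x is a complete subtree T[x] of T (a node of T, identified with
-- the subtree it roots; leaves are distinct, so this identification is faithful).
data _⊑_ : Tree → Tree → Set where
  here : ∀ {t} → t ⊑ t
  inl  : ∀ {t l r} → t ⊑ l → t ⊑ node l r
  inr  : ∀ {t l r} → t ⊑ r → t ⊑ node l r

-- Equality of trees as leaf-labelled (unordered) trees.
data _≅_ : Tree → Tree → Set where
  leaf≅ : ∀ {a} → leaf a ≅ leaf a
  straight : ∀ {l r l' r'} → l ≅ l' → r ≅ r' → node l r ≅ node l' r'
  swapped  : ∀ {l r l' r'} → l ≅ r' → r ≅ l' → node l r ≅ node l' r'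

-- Possibly-empty trees (restriction to an empty leaf set gives nothing).
data _≅M_ : Maybe Tree → Maybe Tree → Set where
  nothing≅ : nothing ≅M nothing
  just≅    : ∀ {t t'} → t ≅ t' → just t ≅M just t'

-- T_{|L'} for L' given by a Boolean predicate: induced subtree, rooted at the
-- lca, with degree-2 nodes suppressed.
combine : Maybe Tree → Maybe Tree → Maybe Tree
combine nothing  m        = m
combine (just t) nothing  = just t
combine (just t) (just u) = just (node t u)

restrictBy : (ℕ → Bool) → Tree → Maybe Tree
restrictBy p (leaf a) with p a
... | true  = just (leaf a)
... | false = nothing
restrictBy p (node l r) = combine (restrictBy p l) (restrictBy p r)

_∣_ : Tree → List ℕ → Maybe Tree
T ∣ S = restrictBy (λ a → does (a ∈? S)) T

minus : Tree → List ℕ → Maybe Tree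
minus T S = restrictBy (λ a → does (a ∈? leaves T) ∧ not (does (a ∈? S))) T

IsLCA : Tree → List ℕ → Tree → Set
IsLCA T S x = x ⊑ T × S ⊆ leaves x × (∀ y → y ⊑ x → S ⊆ leaves y → y ≡ x)

module Setting (G : Tree) (gene : ℕ → ℕ) (P : Tree) where

  genesOf : Tree → List ℕ
  genesOf t = map gene (leaves t)

  -- l_P(x) = Creat  iff  g(x) = g(x_l) or g(x) = g(x_r),
  -- where g(x) = lca_G(genes of the leaves below x).
  Creat : Tree → Set
  Creat (leaf _)   = ⊥
  Creat (node l r) = ∃[ y ] (IsLCA G (genesOf (node l r)) y
                             × (IsLCA G (genesOf l) y ⊎ IsLCA G (genesOf r) y))

  Orthologs : ℕ → ℕ → Set
  Orthologs x y = ∀ z → IsLCA P (x ∷ y ∷ []) z → ¬ Creat z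

  CreationFree : List ℕ → Set
  CreationFree L = L ⊆ leaves P × (∀ a b → a ∈ L → b ∈ L → a ≢ b → Orthologs a b)

  MaxCF : List ℕ → Set
  MaxCF L = CreationFree L × (∀ L' → CreationFree L' → L ⊆ L' → L' ⊆ L)

  -- The trees P_i of ℙ are P_{|L} for L with MaxCF L;
  -- P_i ∈ span(x) iff x ∈ L.
  SameSpan : ℕ → ℕ → Set
  SameSpan x y = ∀ L → MaxCF L → (x ∈ L → y ∈ L) × (y ∈ L → x ∈ L)

  SpanClass : List ℕ → Set
  SpanClass S = ∃[ x ] (x ∈ leaves P ×
                 (∀ y → (y ∈ S → y ∈ leaves P × SameSpan x y)
                       × (y ∈ leaves P × SameSpan x y → y ∈ S)))

  -- P_i = P_{|L} ∈ span(S) (span(S) = span(x) for any x ∈ S).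
  InSpan : List ℕ → List ℕ → Set
  InSpan L S = ∃[ x ] (x ∈ S × x ∈ L)

  IsComplete : List ℕ → Set
  IsComplete S = ∃[ x ] (x ⊑ P × (P ∣ S) ≅M just x)

  GoodPair : List ℕ → List ℕ → Set
  GoodPair Su Sv = SpanClass Su × SpanClass Sv × ¬ (Su ⊆ Sv × Sv ⊆ Su)
                   × IsComplete Su × IsComplete Sv × IsComplete (Su ++ Sv)

  Conclusions : List ℕ → List ℕ → Set
  Conclusions Su Sv =
      (∀ x → IsLCA P (Su ++ Sv) x → Creat x)
    × (∀ St → (St ≡ Su ⊎ St ≡ Sv) → ∀ L → MaxCF L → InSpan L St →
         (P ∣ St) ≅M ((P ∣ L) >>= λ Pi → Pi ∣ St))
    × (∀ L → MaxCF L → InSpan L Su → InSpan L Sv → ⊥)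
    × (∀ L → MaxCF L → InSpan L Su → ∃[ L' ] (MaxCF L' × InSpan L' Sv ×
          ((P ∣ L) >>= λ Pi → minus Pi Su) ≅M ((P ∣ L') >>= λ Pi → minus Pi Sv)))
    × (∀ L' → MaxCF L' → InSpan L' Sv → ∃[ L ] (MaxCF L × InSpan L Su ×
          ((P ∣ L) >>= λ Pi → minus Pi Su) ≅M ((P ∣ L') >>= λ Pi → minus Pi Sv)))

-- A lowest creation node X = node l r of P has creation-free children, so U = L(l) and V = L(r)
-- are creation-free, and since X is a creation no creation-free set meets both. Orthology to a
-- protein outside X does not depend on which protein of X is chosen; hence a maximal creation-free
-- set meeting U contains all of U, and replacing its part in U by V gives a maximal creation-free set
-- again. So U and V are span classes, no P_i spans both, and exchanging U for V matches the P_i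
-- spanning U with those spanning V, leaving the trees outside U resp. V unchanged. Conversely, for
-- span classes U, V with P_{|U}, P_{|V}, P_{|U∪V} complete, P_{|U} and P_{|V} are the children of
-- P_{|U∪V}, and that node is a creation: otherwise every pair across U and V would be orthologous,
-- a maximal set meeting U would absorb V, and U, V would be the same span class.

module Submission where

open import Defs
open import Data.Nat using (ℕ) renaming (_≟_ to _≟ℕ_)
open import Data.Bool using (true; false; _∧_; if_then_else_)
open import Data.Maybe using (Maybe; just; nothing; _>>=_)
open import Data.List using (List; []; _∷_; _++_; filter)
open import Data.List.Properties using (++-identityʳ)
open import Data.List.Membership.Propositional using (_∈_; _∉_)
open import Data.List.Membership.Propositional.Properties
  using (∈-++⁺ˡ; ∈-++⁺ʳ; ∈-++⁻; ∈-map⁺; ∈-map⁻; ∈-filter⁺; ∈-filter⁻)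
open import Data.List.Membership.DecPropositional _≟ℕ_ using (_∈?_; _∉?_)
open import Data.List.Relation.Binary.Subset.DecPropositional _≟ℕ_ using (_⊆_; _⊆?_)
open import Data.List.Relation.Binary.Disjoint.Propositional using (Disjoint)
open import Data.List.Relation.Unary.Unique.Propositional using (Unique)
open import Data.List.Relation.Unary.AllPairs using ([]; _∷_)
open import Data.List.Relation.Unary.Any using (here; there)
open import Data.List.Relation.Unary.All using (All; all?; [])
import Data.List.Relation.Unary.All as All
import Data.List.Relation.Unary.All.Properties as All
open import Data.Product using (_×_; ∃-syntax; _,_; proj₁; proj₂)
open import Data.Sum using (_⊎_; inj₁; inj₂; [_,_]′)
import Data.Sum as Sum
open import Data.Empty using (⊥; ⊥-elim)
open import Function using (id; _∘_; _⇔_; mk⇔)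
open import Relation.Nullary using (¬_; Dec; yes; no; does; ¬?; _×-dec_; _⊎-dec_; _→-dec_; map′)
open import Relation.Nullary.Decidable using (does-⇔)
open import Relation.Binary.PropositionalEquality using (_≡_; _≢_; refl; sym; trans; cong₂; subst; module ≡-Reasoning)
open import Relation.Unary using (Pred; Decidable)
open import Level using (0ℓ)

Unique-++⁻ˡ : ∀ xs {ys : List ℕ} → Unique (xs ++ ys) → Unique xs
Unique-++⁻ˡ []       _          = []
Unique-++⁻ˡ (x ∷ xs) (x∉ ∷ xs!) = All.++⁻ˡ xs x∉ ∷ Unique-++⁻ˡ xs xs!

Unique-++⁻ʳ : ∀ xs {ys : List ℕ} → Unique (xs ++ ys) → Unique ys
Unique-++⁻ʳ []       ys!       = ys!
Unique-++⁻ʳ (x ∷ xs) (_ ∷ xs!) = Unique-++⁻ʳ xs xs!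

Unique-++⇒Disjoint : ∀ xs {ys : List ℕ} → Unique (xs ++ ys) → Disjoint xs ys
Unique-++⇒Disjoint (x ∷ xs) (x∉ ∷ _) (here refl , v∈ys) = All.lookup (All.++⁻ʳ xs x∉) v∈ys refl
Unique-++⇒Disjoint (x ∷ xs) (_ ∷ xs!) (there v∈xs , v∈ys) = Unique-++⇒Disjoint xs xs! (v∈xs , v∈ys)

-- Trees

_≟ᵀ_ : (s t : Tree) → Dec (s ≡ t)
leaf a ≟ᵀ leaf b with a ≟ℕ b
... | yes refl = yes refl
... | no a≢b   = no λ { refl → a≢b refl }
leaf _ ≟ᵀ node _ _ = no λ ()
node _ _ ≟ᵀ leaf _ = no λ ()
node l r ≟ᵀ node l′ r′ with l ≟ᵀ l′ | r ≟ᵀ r′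
... | yes refl | yes refl = yes refl
... | no l≢l′  | _        = no λ { refl → l≢l′ refl }
... | _        | no r≢r′  = no λ { refl → r≢r′ refl }

leaves-nonempty : ∀ t → ∃[ c ] (c ∈ leaves t)
leaves-nonempty (leaf a)   = a , here refl
leaves-nonempty (node l r) = let c , c∈l = leaves-nonempty l in c , ∈-++⁺ˡ c∈l

⊑-trans : ∀ {s t T} → s ⊑ t → t ⊑ T → s ⊑ T
⊑-trans s⊑t here    = s⊑t
⊑-trans s⊑t (inl q) = inl (⊑-trans s⊑t q)
⊑-trans s⊑t (inr q) = inr (⊑-trans s⊑t q)

⊑-leaves : ∀ {t T} → t ⊑ T → leaves t ⊆ leaves T
⊑-leaves here    = id
⊑-leaves (inl p) = ∈-++⁺ˡ ∘ ⊑-leaves p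
⊑-leaves (inr {l = l} p) = ∈-++⁺ʳ (leaves l) ∘ ⊑-leaves p

⊑-unique : ∀ {t T} → t ⊑ T → Unique (leaves T) → Unique (leaves t)
⊑-unique here u = u
⊑-unique (inl {l = l} p) u = ⊑-unique p (Unique-++⁻ˡ (leaves l) u)
⊑-unique (inr {l = l} p) u = ⊑-unique p (Unique-++⁻ʳ (leaves l) u)

children-disjoint : ∀ l r → Unique (leaves (node l r)) → Disjoint (leaves l) (leaves r)
children-disjoint l _ = Unique-++⇒Disjoint (leaves l)

⊑-nested : ∀ {T s t c} → Unique (leaves T) → s ⊑ T → t ⊑ T → c ∈ leaves s → c ∈ leaves t
  → s ⊑ t ⊎ t ⊑ s
⊑-nested u here    t⊑T     _   _   = inj₂ t⊑T
⊑-nested u (inl p) here    _   _   = inj₁ (inl p)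
⊑-nested u (inr p) here    _   _   = inj₁ (inr p)
⊑-nested {node l r} u (inl p) (inl q) c∈s c∈t = ⊑-nested (Unique-++⁻ˡ (leaves l) u) p q c∈s c∈t
⊑-nested {node l r} u (inr p) (inr q) c∈s c∈t = ⊑-nested (Unique-++⁻ʳ (leaves l) u) p q c∈s c∈t
⊑-nested {node l r} u (inl p) (inr q) c∈s c∈t = ⊥-elim (children-disjoint l r u (⊑-leaves p c∈s , ⊑-leaves q c∈t))
⊑-nested {node l r} u (inr p) (inl q) c∈s c∈t = ⊥-elim (children-disjoint l r u (⊑-leaves q c∈t , ⊑-leaves p c∈s))

⊑-antisym-leaves : ∀ {t T} → Unique (leaves T) → t ⊑ T → leaves T ⊆ leaves t → t ≡ T
⊑-antisym-leaves u here    _ = refl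
⊑-antisym-leaves {T = node l r} u (inl p) T⊆t =
  let c , c∈r = leaves-nonempty r
  in ⊥-elim (children-disjoint l r u (⊑-leaves p (T⊆t (∈-++⁺ʳ (leaves l) c∈r)) , c∈r))
⊑-antisym-leaves {T = node l r} u (inr p) T⊆t =
  let c , c∈l = leaves-nonempty l
  in ⊥-elim (children-disjoint l r u (c∈l , ⊑-leaves p (T⊆t (∈-++⁺ˡ c∈l))))

⊑-from-⊆ : ∀ {T s t} → Unique (leaves T) → s ⊑ T → t ⊑ T → leaves s ⊆ leaves t → s ⊑ t
⊑-from-⊆ {s = s} u s⊑T t⊑T s⊆t with leaves-nonempty s
... | c , c∈s with ⊑-nested u s⊑T t⊑T c∈s (s⊆t c∈s)
...   | inj₁ s⊑t = s⊑t
...   | inj₂ t⊑s = subst (_⊑ _) (⊑-antisym-leaves (⊑-unique s⊑T u) t⊑s s⊆t) here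

⊑-children-fill : ∀ {l r s₁ s₂} → Unique (leaves (node l r)) → s₁ ⊑ l → s₂ ⊑ r
  → (∀ {c} → c ∈ leaves (node l r) → c ∈ leaves s₁ ⊎ c ∈ leaves s₂)
  → node l r ≡ node s₁ s₂
⊑-children-fill {l} {r} {s₁} {s₂} u s₁⊑l s₂⊑r cover =
  cong₂ node (sym (⊑-antisym-leaves (Unique-++⁻ˡ (leaves l) u) s₁⊑l l⊆s₁))
             (sym (⊑-antisym-leaves (Unique-++⁻ʳ (leaves l) u) s₂⊑r r⊆s₂))
  where
  l⊆s₁ : leaves l ⊆ leaves s₁
  l⊆s₁ c∈l = [ id , (λ c∈s₂ → ⊥-elim (children-disjoint l r u (c∈l , ⊑-leaves s₂⊑r c∈s₂))) ]′
               (cover (∈-++⁺ˡ c∈l))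
  r⊆s₂ : leaves r ⊆ leaves s₂
  r⊆s₂ c∈r = [ (λ c∈s₁ → ⊥-elim (children-disjoint l r u (⊑-leaves s₁⊑l c∈s₁ , c∈r))) , id ]′
               (cover (∈-++⁺ʳ (leaves l) c∈r))

⊑-children : ∀ {t s₁ s₂} → Unique (leaves t) → s₁ ⊑ t → s₂ ⊑ t → Disjoint (leaves s₁) (leaves s₂)
  → (∀ {c} → c ∈ leaves t → c ∈ leaves s₁ ⊎ c ∈ leaves s₂)
  → t ≡ node s₁ s₂ ⊎ t ≡ node s₂ s₁
⊑-children {s₂ = s₂} _ here s₂⊑t s₁#s₂ _ =
  let c , c∈s₂ = leaves-nonempty s₂ in ⊥-elim (s₁#s₂ (⊑-leaves s₂⊑t c∈s₂ , c∈s₂))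
⊑-children {s₁ = s₁} _ s₁⊑t@(inl _) here s₁#s₂ _ =
  let c , c∈s₁ = leaves-nonempty s₁ in ⊥-elim (s₁#s₂ (c∈s₁ , ⊑-leaves s₁⊑t c∈s₁))
⊑-children {s₁ = s₁} _ s₁⊑t@(inr _) here s₁#s₂ _ =
  let c , c∈s₁ = leaves-nonempty s₁ in ⊥-elim (s₁#s₂ (c∈s₁ , ⊑-leaves s₁⊑t c∈s₁))
⊑-children u (inl p) (inr q) _ cover = inj₁ (⊑-children-fill u p q cover)
⊑-children u (inr p) (inl q) _ cover = inj₂ (⊑-children-fill u q p (Sum.swap ∘ cover))
⊑-children {node l r} u (inl p) (inl q) _ cover =
  let c , c∈r = leaves-nonempty r
  in ⊥-elim (children-disjoint l r u
       ([ ⊑-leaves p , ⊑-leaves q ]′ (cover (∈-++⁺ʳ (leaves l) c∈r)) , c∈r))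
⊑-children {node l r} u (inr p) (inr q) _ cover =
  let c , c∈l = leaves-nonempty l
  in ⊥-elim (children-disjoint l r u
       (c∈l , [ ⊑-leaves p , ⊑-leaves q ]′ (cover (∈-++⁺ˡ c∈l))))

-- Lowest common ancestors

lca-unique : ∀ {T S y y′ c} → Unique (leaves T) → c ∈ S → IsLCA T S y → IsLCA T S y′ → y ≡ y′
lca-unique u c∈S (y⊑T , S⊆y , min) (y′⊑T , S⊆y′ , min′) with ⊑-nested u y⊑T y′⊑T (S⊆y c∈S) (S⊆y′ c∈S)
... | inj₁ y⊑y′ = min′ _ y⊑y′ S⊆y
... | inj₂ y′⊑y = sym (min _ y′⊑y S⊆y′)

IsLCA-swap : ∀ {T a b y} → IsLCA T (a ∷ b ∷ []) y → IsLCA T (b ∷ a ∷ []) y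
IsLCA-swap (y⊑T , ab⊆y , min) = y⊑T , ab⊆y ∘ swap , λ w w⊑y ba⊆w → min w w⊑y (ba⊆w ∘ swap)
  where
  swap : ∀ {a b c : ℕ} → c ∈ a ∷ b ∷ [] → c ∈ b ∷ a ∷ []
  swap (here refl)         = there (here refl)
  swap (there (here refl)) = here refl

lca-exists : ∀ T S → S ⊆ leaves T → ∃[ y ] IsLCA T S y
lca-exists (leaf a) S S⊆T = leaf a , here , S⊆T , λ { _ here _ → refl }
lca-exists (node l r) S S⊆T with S ⊆? leaves l | S ⊆? leaves r
... | yes S⊆l | _ = let y , y⊑l , rest = lca-exists l S S⊆l in y , inl y⊑l , rest
... | no _ | yes S⊆r = let y , y⊑r , rest = lca-exists r S S⊆r in y , inr y⊑r , rest
... | no S⊈l | no S⊈r = node l r , here , S⊆T , min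
  where
  min : ∀ w → w ⊑ node l r → S ⊆ leaves w → w ≡ node l r
  min _ here    _   = refl
  min _ (inl q) S⊆w = ⊥-elim (S⊈l (⊑-leaves q ∘ S⊆w))
  min _ (inr q) S⊆w = ⊥-elim (S⊈r (⊑-leaves q ∘ S⊆w))

lca-children : ∀ {T l r a b} → Unique (leaves T) → node l r ⊑ T → a ∈ leaves l → b ∈ leaves r
  → IsLCA T (a ∷ b ∷ []) (node l r)
lca-children {l = l} {r} u X⊑T a∈l b∈r = X⊑T , ab⊆X , min
  where
  ab⊆X : _ ⊆ leaves (node l r)
  ab⊆X (here refl)         = ∈-++⁺ˡ a∈l
  ab⊆X (there (here refl)) = ∈-++⁺ʳ (leaves l) b∈r
  disjoint = children-disjoint l r (⊑-unique X⊑T u)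
  min : ∀ w → w ⊑ node l r → _ ⊆ leaves w → w ≡ node l r
  min _ here    _    = refl
  min _ (inl q) ab⊆w = ⊥-elim (disjoint (⊑-leaves q (ab⊆w (there (here refl))) , b∈r))
  min _ (inr q) ab⊆w = ⊥-elim (disjoint (a∈l , ⊑-leaves q (ab⊆w (here refl))))

lca-⊑ : ∀ {T S t z c} → Unique (leaves T) → t ⊑ T → c ∈ S → S ⊆ leaves t → IsLCA T S z → z ⊑ t
lca-⊑ u t⊑T c∈S S⊆t (z⊑T , S⊆z , min) with ⊑-nested u z⊑T t⊑T (S⊆z c∈S) (S⊆t c∈S)
... | inj₁ z⊑t = z⊑t
... | inj₂ t⊑z = subst (_⊑ _) (min _ t⊑z S⊆t) here

-- For y outside X, lca_T(y, s) is a proper ancestor of X, whichever s in X is chosen.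
lca-outside : ∀ {T X y s s′ z} → Unique (leaves T) → X ⊑ T → y ∉ leaves X
  → s ∈ leaves X → s′ ∈ leaves X → IsLCA T (y ∷ s ∷ []) z → IsLCA T (y ∷ s′ ∷ []) z
lca-outside {y = y} {s} {s′} {z} u X⊑T y∉X s∈X s′∈X (z⊑T , ys⊆z , min)
  with ⊑-nested u X⊑T z⊑T s∈X (ys⊆z (there (here refl)))
... | inj₂ z⊑X = ⊥-elim (y∉X (⊑-leaves z⊑X (ys⊆z (here refl))))
... | inj₁ X⊑z = z⊑T , ys′⊆z , min′
  where
  ys′⊆z : y ∷ s′ ∷ [] ⊆ leaves z
  ys′⊆z (here refl)         = ys⊆z (here refl)
  ys′⊆z (there (here refl)) = ⊑-leaves X⊑z s′∈X
  min′ : ∀ w → w ⊑ z → y ∷ s′ ∷ [] ⊆ leaves w → w ≡ z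
  min′ w w⊑z ys′⊆w with ⊑-nested u X⊑T (⊑-trans w⊑z z⊑T) s′∈X (ys′⊆w (there (here refl)))
  ... | inj₂ w⊑X = ⊥-elim (y∉X (⊑-leaves w⊑X (ys′⊆w (here refl))))
  ... | inj₁ X⊑w = min w w⊑z λ { (here refl) → ys′⊆w (here refl) ; (there (here refl)) → ⊑-leaves X⊑w s∈X }

-- Restrictions

leavesᴹ : Maybe Tree → List ℕ
leavesᴹ nothing  = []
leavesᴹ (just t) = leaves t

leavesᴹ-combine : ∀ m n → leavesᴹ (combine m n) ≡ leavesᴹ m ++ leavesᴹ n
leavesᴹ-combine nothing  _        = refl
leavesᴹ-combine (just t) nothing  = sym (++-identityʳ (leaves t))
leavesᴹ-combine (just _) (just _) = refl

≅-leaves : ∀ {t t′} → t ≅ t′ → leaves t ⊆ leaves t′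
≅-leaves leaf≅ = id
≅-leaves {node l r} {node l′ r′} (straight l≅ r≅) c∈ =
  [ ∈-++⁺ˡ ∘ ≅-leaves l≅ , ∈-++⁺ʳ (leaves l′) ∘ ≅-leaves r≅ ]′ (∈-++⁻ (leaves l) c∈)
≅-leaves {node l r} {node l′ r′} (swapped l≅ r≅) c∈ =
  [ ∈-++⁺ʳ (leaves l′) ∘ ≅-leaves l≅ , ∈-++⁺ˡ ∘ ≅-leaves r≅ ]′ (∈-++⁻ (leaves l) c∈)

≅-sym : ∀ {t t′} → t ≅ t′ → t′ ≅ t
≅-sym leaf≅          = leaf≅
≅-sym (straight p q) = straight (≅-sym p) (≅-sym q)
≅-sym (swapped p q)  = swapped (≅-sym q) (≅-sym p)

≅-refl : ∀ {t} → t ≅ t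
≅-refl {leaf _}   = leaf≅
≅-refl {node _ _} = straight ≅-refl ≅-refl

≡⇒≅M : ∀ {m n} → m ≡ n → m ≅M n
≡⇒≅M {nothing} refl = nothing≅
≡⇒≅M {just _}  refl = just≅ ≅-refl

restrictBy-cong : ∀ {p q} T → (∀ {a} → a ∈ leaves T → p a ≡ q a) → restrictBy p T ≡ restrictBy q T
restrictBy-cong {p} {q} (leaf a) p≗q with p a | q a | p≗q (here refl)
... | true  | .true  | refl = refl
... | false | .false | refl = refl
restrictBy-cong (node l r) p≗q =
  cong₂ combine (restrictBy-cong l (p≗q ∘ ∈-++⁺ˡ)) (restrictBy-cong r (p≗q ∘ ∈-++⁺ʳ (leaves l)))

restrictBy->>= : ∀ p q T → (restrictBy p T >>= restrictBy q) ≡ restrictBy (λ a → p a ∧ q a) T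
restrictBy->>= p q (leaf a) with p a
... | true  = refl
... | false = refl
restrictBy->>= p q (node l r) = begin
  (combine (restrictBy p l) (restrictBy p r) >>= restrictBy q)
    ≡⟨ combine->>= (restrictBy p l) (restrictBy p r) ⟩
  combine (restrictBy p l >>= restrictBy q) (restrictBy p r >>= restrictBy q)
    ≡⟨ cong₂ combine (restrictBy->>= p q l) (restrictBy->>= p q r) ⟩
  combine (restrictBy (λ a → p a ∧ q a) l) (restrictBy (λ a → p a ∧ q a) r) ∎
  where
  open ≡-Reasoning
  combine->>= : ∀ m n → (combine m n >>= restrictBy q) ≡ combine (m >>= restrictBy q) (n >>= restrictBy q)
  combine->>= nothing  _        = refl
  combine->>= (just t) nothing  with restrictBy q t
  ... | nothing = refl
  ... | just _  = refl
  combine->>= (just _) (just _) = refl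

-- T ∣ S is T ∣[ _∈? S ] definitionally.
_∣[_] : {Q : Pred ℕ 0ℓ} → Tree → Decidable Q → Maybe Tree
T ∣[ Q? ] = restrictBy (does ∘ Q?) T

∣[]-cong : ∀ {Q R : Pred ℕ 0ℓ} (Q? : Decidable Q) (R? : Decidable R) T
  → (∀ {a} → a ∈ leaves T → Q a ⇔ R a) → T ∣[ Q? ] ≡ T ∣[ R? ]
∣[]-cong Q? R? T Q⇔R = restrictBy-cong T λ {a} a∈T → does-⇔ (Q⇔R a∈T) (Q? a) (R? a)

∈-∣[]⁻ : ∀ {Q : Pred ℕ 0ℓ} (Q? : Decidable Q) T {a} → a ∈ leavesᴹ (T ∣[ Q? ]) → a ∈ leaves T × Q a
∈-∣[]⁻ Q? (leaf b) a∈ with Q? b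
∈-∣[]⁻ Q? (leaf b) (here refl) | yes Qb = here refl , Qb
∈-∣[]⁻ Q? (node l r) a∈
  rewrite leavesᴹ-combine (l ∣[ Q? ]) (r ∣[ Q? ]) with ∈-++⁻ (leavesᴹ (l ∣[ Q? ])) a∈
... | inj₁ a∈l = let a∈T , Qa = ∈-∣[]⁻ Q? l a∈l in ∈-++⁺ˡ a∈T , Qa
... | inj₂ a∈r = let a∈T , Qa = ∈-∣[]⁻ Q? r a∈r in ∈-++⁺ʳ (leaves l) a∈T , Qa

∈-∣[]⁺ : ∀ {Q : Pred ℕ 0ℓ} (Q? : Decidable Q) T {a} → a ∈ leaves T → Q a → a ∈ leavesᴹ (T ∣[ Q? ])
∈-∣[]⁺ Q? (leaf b) (here refl) Qb with Q? b
... | yes _  = here refl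
... | no ¬Qb = ⊥-elim (¬Qb Qb)
∈-∣[]⁺ Q? (node l r) a∈ Qa
  rewrite leavesᴹ-combine (l ∣[ Q? ]) (r ∣[ Q? ]) with ∈-++⁻ (leaves l) a∈
... | inj₁ a∈l = ∈-++⁺ˡ (∈-∣[]⁺ Q? l a∈l Qa)
... | inj₂ a∈r = ∈-++⁺ʳ (leavesᴹ (l ∣[ Q? ])) (∈-∣[]⁺ Q? r a∈r Qa)

∣[]-all : ∀ {Q : Pred ℕ 0ℓ} (Q? : Decidable Q) T → (∀ {a} → a ∈ leaves T → Q a) → T ∣[ Q? ] ≡ just T
∣[]-all Q? (leaf a) all with Q? a
... | yes _  = refl
... | no ¬Qa = ⊥-elim (¬Qa (all (here refl)))
∣[]-all Q? (node l r) all
  rewrite ∣[]-all Q? l (all ∘ ∈-++⁺ˡ) | ∣[]-all Q? r (all ∘ ∈-++⁺ʳ (leaves l)) = refl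

∣[]-none : ∀ {Q : Pred ℕ 0ℓ} (Q? : Decidable Q) T → (∀ {a} → a ∈ leaves T → ¬ Q a) → T ∣[ Q? ] ≡ nothing
∣[]-none Q? (leaf a) none with Q? a
... | yes Qa = ⊥-elim (none (here refl) Qa)
... | no _   = refl
∣[]-none Q? (node l r) none
  rewrite ∣[]-none Q? l (none ∘ ∈-++⁺ˡ) | ∣[]-none Q? r (none ∘ ∈-++⁺ʳ (leaves l)) = refl

∣-leaves : ∀ {t T} → Unique (leaves T) → t ⊑ T → T ∣ leaves t ≡ just t
∣-leaves {t} _ here = ∣[]-all (_∈? leaves t) t id
∣-leaves {t} u (inl {l = l} {r} p)
  rewrite ∣-leaves (Unique-++⁻ˡ (leaves l) u) p
        | ∣[]-none (_∈? leaves t) r (λ a∈r a∈t → children-disjoint l r u (⊑-leaves p a∈t , a∈r)) = refl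
∣-leaves {t} u (inr {l = l} {r} p)
  rewrite ∣-leaves (Unique-++⁻ʳ (leaves l) u) p
        | ∣[]-none (_∈? leaves t) l (λ a∈l a∈t → children-disjoint l r u (a∈l , ⊑-leaves p a∈t)) = refl

∣-complete-leaves : ∀ T {S x} → S ⊆ leaves T → (T ∣ S) ≅M just x → leaves x ⊆ S × S ⊆ leaves x
∣-complete-leaves T {S} S⊆T T∣S≅x with T ∣ S in eq
∣-complete-leaves T {S} S⊆T (just≅ t≅x) | just t =
  (λ a∈x → proj₂ (∈-∣[]⁻ (_∈? S) T (subst (λ m → _ ∈ leavesᴹ m) (sym eq) (≅-leaves (≅-sym t≅x) a∈x)))) ,
  (λ a∈S → ≅-leaves t≅x (subst (λ m → _ ∈ leavesᴹ m) eq (∈-∣[]⁺ (_∈? S) T (S⊆T a∈S) a∈S)))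

_∈?_∖_ : ∀ a L S → Dec (a ∈ L × a ∉ S)
a ∈? L ∖ S = a ∈? L ×-dec a ∉? S

minus-∣[] : ∀ T S → minus T S ≡ T ∣[ _∉? S ]
minus-∣[] T S = ∣[]-cong (_∈? leaves T ∖ S) (_∉? S) T
                  λ a∈T → mk⇔ proj₂ (a∈T ,_)

∣->>=-minus : ∀ T L S → ((T ∣ L) >>= λ Pi → minus Pi S) ≡ T ∣[ _∈? L ∖ S ]
∣->>=-minus T L S = trans (cong-bind (T ∣ L)) (restrictBy->>= _ _ T)
  where
  cong-bind : ∀ m → (m >>= λ Pi → minus Pi S) ≡ (m >>= _∣[ _∉? S ])
  cong-bind nothing   = refl
  cong-bind (just Pi) = minus-∣[] Pi S

-- Orthology and creation-free sets

exchange : List ℕ → List ℕ → List ℕ → List ℕ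
exchange U V L = filter (_∉? U) L ++ V

∈-exchange⁻ : ∀ U V L {y} → y ∈ exchange U V L → (y ∈ L × y ∉ U) ⊎ y ∈ V
∈-exchange⁻ U V L y∈ = Sum.map₁ (∈-filter⁻ (_∉? U)) (∈-++⁻ (filter (_∉? U) L) y∈)

∈-exchange⁺ˡ : ∀ {U} V {L y} → y ∈ L → y ∉ U → y ∈ exchange U V L
∈-exchange⁺ˡ {U} _ y∈L y∉U = ∈-++⁺ˡ (∈-filter⁺ (_∉? U) y∈L y∉U)

∈-exchange⁺ʳ : ∀ U {V} L {y} → y ∈ V → y ∈ exchange U V L
∈-exchange⁺ʳ U L = ∈-++⁺ʳ (filter (_∉? U) L)

module Reconciled (G : Tree) (gene : ℕ → ℕ) (P : Tree)
                  (uG : Unique (leaves G)) (uP : Unique (leaves P)) where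
  open Setting G gene P

  genesOf-⊆ : ∀ {s t} → leaves s ⊆ leaves t → genesOf s ⊆ genesOf t
  genesOf-⊆ s⊆t g∈ with ∈-map⁻ gene g∈
  ... | _ , c∈s , refl = ∈-map⁺ gene (s⊆t c∈s)

  lcaG-unique : ∀ t {y y′} → IsLCA G (genesOf t) y → IsLCA G (genesOf t) y′ → y ≡ y′
  lcaG-unique t = lca-unique uG (∈-map⁺ gene (proj₂ (leaves-nonempty t)))

  creat? : ∀ t → Dec (Creat t)
  creat? (leaf _) = no λ ()
  creat? (node l r) with genesOf (node l r) ⊆? leaves G
  ... | no ⊈G = no λ (_ , (y⊑G , S⊆y , _) , _) → ⊈G (⊑-leaves y⊑G ∘ S⊆y)
  ... | yes ⊆G with lca-exists G (genesOf (node l r)) ⊆G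
                  | lca-exists G (genesOf l) (⊆G ∘ genesOf-⊆ {l} {node l r} ∈-++⁺ˡ)
                  | lca-exists G (genesOf r) (⊆G ∘ genesOf-⊆ {r} {node l r} (∈-++⁺ʳ (leaves l)))
  ... | y , lca | yl , lcaˡ | yr , lcaʳ =
    map′ (λ { (inj₁ refl) → y , lca , inj₁ lcaˡ ; (inj₂ refl) → y , lca , inj₂ lcaʳ })
         (λ { (y′ , lca′ , inj₁ lcaˡ′) → inj₁ (trans (lcaG-unique (node l r) lca lca′) (lcaG-unique l lcaˡ′ lcaˡ))
            ; (y′ , lca′ , inj₂ lcaʳ′) → inj₂ (trans (lcaG-unique (node l r) lca lca′) (lcaG-unique r lcaʳ′ lcaʳ)) })
         ((y ≟ᵀ yl) ⊎-dec (y ≟ᵀ yr))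

  orthologs? : ∀ a b → Dec (Orthologs a b)
  orthologs? a b with (a ∷ b ∷ []) ⊆? leaves P
  ... | no ⊈P = yes λ _ (z⊑P , ab⊆z , _) _ → ⊈P (⊑-leaves z⊑P ∘ ab⊆z)
  ... | yes ⊆P with lca-exists P (a ∷ b ∷ []) ⊆P
  ...   | z , lca = map′ (λ ¬creat z′ lca′ → ¬creat ∘ subst Creat (lca-unique uP (here refl) lca′ lca))
                         (λ orth → orth z lca)
                         (¬? (creat? z))

  orthologs-sym : ∀ {a b} → Orthologs a b → Orthologs b a
  orthologs-sym orth z = orth z ∘ IsLCA-swap

  orthologs-outside : ∀ {X y s s′} → X ⊑ P → y ∉ leaves X → s ∈ leaves X → s′ ∈ leaves X
    → Orthologs y s → Orthologs y s′
  orthologs-outside X⊑P y∉X s∈X s′∈X orth z = orth z ∘ lca-outside uP X⊑P y∉X s′∈X s∈X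

  CreationFree-⊆ : ∀ {A B} → A ⊆ B → CreationFree B → CreationFree A
  CreationFree-⊆ A⊆B (B⊆P , orth) = B⊆P ∘ A⊆B , λ a b a∈A b∈A → orth a b (A⊆B a∈A) (A⊆B b∈A)

  CreationFree-++ : ∀ {A B} → CreationFree A → CreationFree B
    → (∀ {a b} → a ∈ A → b ∈ B → a ≢ b → Orthologs a b) → CreationFree (A ++ B)
  CreationFree-++ {A} {B} (A⊆P , orthA) (B⊆P , orthB) cross = [ A⊆P , B⊆P ]′ ∘ ∈-++⁻ A , orth
    where
    orth : ∀ a b → a ∈ A ++ B → b ∈ A ++ B → a ≢ b → Orthologs a b
    orth a b a∈ b∈ a≢b with ∈-++⁻ A a∈ | ∈-++⁻ A b∈
    ... | inj₁ a∈A | inj₁ b∈A = orthA a b a∈A b∈A a≢b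
    ... | inj₂ a∈B | inj₂ b∈B = orthB a b a∈B b∈B a≢b
    ... | inj₁ a∈A | inj₂ b∈B = cross a∈A b∈B a≢b
    ... | inj₂ a∈B | inj₁ b∈A = orthologs-sym (cross b∈A a∈B (a≢b ∘ sym))

  -- Orthology to a protein outside X is the same for all proteins of X, so only pairs inside X need checking.
  CreationFree-++-within : ∀ {X L A B c} → X ⊑ P → CreationFree L → A ⊆ L → c ∈ L → c ∈ leaves X
    → CreationFree B → B ⊆ leaves X
    → (∀ {y t} → y ∈ A → y ∈ leaves X → t ∈ B → y ≢ t → Orthologs y t)
    → CreationFree (A ++ B)
  CreationFree-++-within {X} X⊑P cfL A⊆L c∈L c∈X cfB B⊆X inside =
    CreationFree-++ (CreationFree-⊆ A⊆L cfL) cfB cross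
    where
    cross : ∀ {y t} → y ∈ _ → t ∈ _ → y ≢ t → Orthologs y t
    cross {y} y∈A t∈B y≢t with y ∈? leaves X
    ... | yes y∈X = inside y∈A y∈X t∈B y≢t
    ... | no y∉X  = orthologs-outside X⊑P y∉X c∈X (B⊆X t∈B)
                      (proj₂ cfL _ _ (A⊆L y∈A) c∈L λ { refl → y∉X c∈X })

  MaxCF-absorbs : ∀ {L T} → MaxCF L → CreationFree (L ++ T) → T ⊆ L
  MaxCF-absorbs {L} (_ , max) cf = max _ cf ∈-++⁺ˡ ∘ ∈-++⁺ʳ L

  Compatible : List ℕ → ℕ → Set
  Compatible L q = All (λ m → m ≢ q → Orthologs m q) L

  compatible? : ∀ L q → Dec (Compatible L q)
  compatible? L q = all? (λ m → ¬? (m ≟ℕ q) →-dec orthologs? m q) L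

  CreationFree-∷ : ∀ {L q} → q ∈ leaves P → Compatible L q → CreationFree L → CreationFree (q ∷ L)
  CreationFree-∷ {L} {q} q∈P compat (L⊆P , orthL) = (λ { (here refl) → q∈P ; (there a∈L) → L⊆P a∈L }) , orth
    where
    orth : ∀ a b → a ∈ q ∷ L → b ∈ q ∷ L → a ≢ b → Orthologs a b
    orth a b (here refl) (here refl) a≢b = ⊥-elim (a≢b refl)
    orth a b (here refl) (there b∈L) a≢b = orthologs-sym (All.lookup compat b∈L (a≢b ∘ sym))
    orth a b (there a∈L) (here refl) a≢b = All.lookup compat a∈L a≢b
    orth a b (there a∈L) (there b∈L) a≢b = orthL a b a∈L b∈L a≢b

  extend : List ℕ → List ℕ → List ℕ
  extend L []       = L
  extend L (q ∷ qs) = if does (compatible? L q) then extend (q ∷ L) qs else extend L qs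

  ⊆-extend : ∀ L qs → L ⊆ extend L qs
  ⊆-extend L []       = id
  ⊆-extend L (q ∷ qs) with compatible? L q
  ... | yes _ = ⊆-extend (q ∷ L) qs ∘ there
  ... | no _  = ⊆-extend L qs

  extend-cf : ∀ {L} qs → qs ⊆ leaves P → CreationFree L → CreationFree (extend L qs)
  extend-cf []       _     cf = cf
  extend-cf {L} (q ∷ qs) qs⊆P cf with compatible? L q
  ... | yes compat = extend-cf qs (qs⊆P ∘ there) (CreationFree-∷ (qs⊆P (here refl)) compat cf)
  ... | no _       = extend-cf qs (qs⊆P ∘ there) cf

  extend-saturated : ∀ L qs {q} → q ∈ qs → q ∈ extend L qs ⊎ ¬ Compatible (extend L qs) q
  extend-saturated L (q ∷ qs) (here refl) with compatible? L q
  ... | yes _       = inj₁ (⊆-extend (q ∷ L) qs (here refl))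
  ... | no ¬compat  = inj₂ (¬compat ∘ All.anti-mono (⊆-extend L qs))
  extend-saturated L (q ∷ qs) (there q∈qs) with compatible? L q
  ... | yes _ = extend-saturated (q ∷ L) qs q∈qs
  ... | no _  = extend-saturated L qs q∈qs

  maximal-extension : ∀ {L} → CreationFree L → ∃[ M ] (MaxCF M × L ⊆ M)
  maximal-extension {L} cf = M , (extend-cf (leaves P) id cf , maximal) , ⊆-extend L (leaves P)
    where
    M = extend L (leaves P)
    maximal : ∀ L′ → CreationFree L′ → M ⊆ L′ → L′ ⊆ M
    maximal L′ (L′⊆P , orth) M⊆L′ q∈L′ with extend-saturated L (leaves P) (L′⊆P q∈L′)
    ... | inj₁ q∈M     = q∈M
    ... | inj₂ ¬compat = ⊥-elim (¬compat (All.tabulate λ m∈M → orth _ _ (M⊆L′ m∈M) q∈L′))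

  maximal-∋ : ∀ {a} → a ∈ leaves P → ∃[ M ] (MaxCF M × a ∈ M)
  maximal-∋ a∈P =
    let M , max , [a]⊆M = maximal-extension (CreationFree-∷ a∈P [] ((λ ()) , λ _ _ ()))
    in M , max , [a]⊆M (here refl)

  -- Span classes

  SameSpan-sym : ∀ {x y} → SameSpan x y → SameSpan y x
  SameSpan-sym same L max = let to , from = same L max in from , to

  SameSpan-trans : ∀ {x y z} → SameSpan x y → SameSpan y z → SameSpan x z
  SameSpan-trans same same′ L max =
    let to , from = same L max ; to′ , from′ = same′ L max in to′ ∘ to , from ∘ from′

  module _ {S} (class : SpanClass S) where
    private
      w    = proj₁ class
      w∈P  = proj₁ (proj₂ class)
      memb = proj₂ (proj₂ class)

    spanClass-⊆ : S ⊆ leaves P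
    spanClass-⊆ {y} = proj₁ ∘ proj₁ (memb y)

    spanClass-sameSpan : ∀ {a b} → a ∈ S → b ∈ S → SameSpan a b
    spanClass-sameSpan {a} {b} a∈S b∈S =
      SameSpan-trans (SameSpan-sym (proj₂ (proj₁ (memb a) a∈S))) (proj₂ (proj₁ (memb b) b∈S))

    spanClass-∈ : ∀ {a b} → a ∈ S → b ∈ leaves P → SameSpan a b → b ∈ S
    spanClass-∈ {a} {b} a∈S b∈P same = proj₂ (memb b) (b∈P , SameSpan-trans (proj₂ (proj₁ (memb a) a∈S)) same)

    InSpan⇒⊆ : ∀ {L} → MaxCF L → InSpan L S → S ⊆ L
    InSpan⇒⊆ {L} max (x , x∈S , x∈L) y∈S = proj₁ (spanClass-sameSpan x∈S y∈S L max) x∈L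

    spanClass-cf : CreationFree S
    spanClass-cf = spanClass-⊆ , orth
      where
      orth : ∀ a b → a ∈ S → b ∈ S → a ≢ b → Orthologs a b
      orth a b a∈S b∈S a≢b =
        let M , max , a∈M = maximal-∋ (spanClass-⊆ a∈S)
        in proj₂ (proj₁ max) a b a∈M (InSpan⇒⊆ max (a , a∈S , a∈M) b∈S) a≢b

    ∣-spanClass : ∀ {L} → MaxCF L → InSpan L S → (P ∣ S) ≡ ((P ∣ L) >>= _∣ S)
    ∣-spanClass {L} max inSpan = trans
      (∣[]-cong (_∈? S) (λ a → a ∈? L ×-dec a ∈? S) P λ _ → mk⇔ (λ a∈S → InSpan⇒⊆ max inSpan a∈S , a∈S) proj₂)
      (sym (restrictBy->>= _ _ P))

  spanClass-overlap : ∀ {S S′ a} → SpanClass S → SpanClass S′ → a ∈ S → a ∈ S′ → S ⊆ S′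
  spanClass-overlap class class′ a∈S a∈S′ b∈S =
    spanClass-∈ class′ a∈S′ (spanClass-⊆ class b∈S) (spanClass-sameSpan class a∈S b∈S)

  -- Splits

  record Split (X : Tree) (U V : List ℕ) : Set where
    field
      X⊑P      : X ⊑ P
      cover    : ∀ {y} → y ∈ leaves X → y ∈ U ⊎ y ∈ V
      lca-UV   : ∀ {a b} → a ∈ U → b ∈ V → IsLCA P (a ∷ b ∷ []) X
      disjoint : Disjoint U V
      cf-U     : CreationFree U
      cf-V     : CreationFree V
      u        : ℕ
      u∈U      : u ∈ U
      v        : ℕ
      v∈V      : v ∈ V

    U⊆X : U ⊆ leaves X
    U⊆X a∈U = proj₁ (proj₂ (lca-UV a∈U v∈V)) (here refl)

    V⊆X : V ⊆ leaves X
    V⊆X b∈V = proj₁ (proj₂ (lca-UV u∈U b∈V)) (there (here refl))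

    lca-U++V : IsLCA P (U ++ V) X
    lca-U++V = X⊑P , [ U⊆X , V⊆X ]′ ∘ ∈-++⁻ U , min
      where
      min : ∀ w → w ⊑ X → U ++ V ⊆ leaves w → w ≡ X
      min w w⊑X U++V⊆w = proj₂ (proj₂ (lca-UV u∈U v∈V)) w w⊑X
        λ { (here refl) → U++V⊆w (∈-++⁺ˡ u∈U) ; (there (here refl)) → U++V⊆w (∈-++⁺ʳ U v∈V) }

  split-swap : ∀ {X U V} → Split X U V → Split X V U
  split-swap s = record
    { X⊑P = X⊑P ; cover = Sum.swap ∘ cover ; lca-UV = λ b∈V a∈U → IsLCA-swap (lca-UV a∈U b∈V)
    ; disjoint = λ (a∈V , a∈U) → disjoint (a∈U , a∈V) ; cf-U = cf-V ; cf-V = cf-U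
    ; u = v ; u∈U = v∈V ; v = u ; v∈V = u∈U }
    where open Split s

  split-children : ∀ {l r U V} → node l r ⊑ P
    → U ⊆ leaves l → leaves l ⊆ U → V ⊆ leaves r → leaves r ⊆ V
    → CreationFree U → CreationFree V → Split (node l r) U V
  split-children {l} {r} X⊑P U⊆l l⊆U V⊆r r⊆V cf-U cf-V = record
    { X⊑P = X⊑P
    ; cover = Sum.map l⊆U r⊆V ∘ ∈-++⁻ (leaves l)
    ; lca-UV = λ a∈U b∈V → lca-children uP X⊑P (U⊆l a∈U) (V⊆r b∈V)
    ; disjoint = λ (a∈U , a∈V) → children-disjoint l r (⊑-unique X⊑P uP) (U⊆l a∈U , V⊆r a∈V)
    ; cf-U = cf-U ; cf-V = cf-V
    ; u = proj₁ (leaves-nonempty l) ; u∈U = l⊆U (proj₂ (leaves-nonempty l))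
    ; v = proj₁ (leaves-nonempty r) ; v∈V = r⊆V (proj₂ (leaves-nonempty r)) }

  module Creation {X U V} (s : Split X U V) (creat : Creat X) where
    open Split s

    no-cross : ∀ {L a b} → CreationFree L → a ∈ L → a ∈ U → b ∈ L → b ∈ V → ⊥
    no-cross (_ , orth) a∈L a∈U b∈L b∈V =
      orth _ _ a∈L b∈L (λ { refl → disjoint (a∈U , b∈V) }) X (lca-UV a∈U b∈V) creat

    saturate : ∀ {L a} → MaxCF L → a ∈ L → a ∈ U → U ⊆ L
    saturate (cf , max) a∈L a∈U = MaxCF-absorbs (cf , max)
      (CreationFree-++-within X⊑P cf id a∈L (U⊆X a∈U) cf-U U⊆X inside)
      where
      inside : ∀ {y t} → y ∈ _ → y ∈ leaves X → t ∈ U → y ≢ t → Orthologs y t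
      inside y∈L y∈X t∈U y≢t with cover y∈X
      ... | inj₁ y∈U = proj₂ cf-U _ _ y∈U t∈U y≢t
      ... | inj₂ y∈V = ⊥-elim (no-cross cf a∈L a∈U y∈L y∈V)

    exchange-cf : ∀ {L a} → CreationFree L → a ∈ L → a ∈ U → CreationFree (exchange U V L)
    exchange-cf {L} cf a∈L a∈U =
      CreationFree-++-within X⊑P cf (proj₁ ∘ kept) a∈L (U⊆X a∈U) cf-V V⊆X inside
      where
      kept : ∀ {y} → y ∈ filter (_∉? U) L → y ∈ L × y ∉ U
      kept = ∈-filter⁻ (_∉? U) {xs = L}
      inside : ∀ {y t} → y ∈ _ → y ∈ leaves X → t ∈ V → y ≢ t → Orthologs y t
      inside y∈L′ y∈X t∈V y≢t with cover y∈X
      ... | inj₁ y∈U = ⊥-elim (proj₂ (kept y∈L′) y∈U)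
      ... | inj₂ y∈V = proj₂ cf-V _ _ y∈V t∈V y≢t

  module _ {X U V} (s : Split X U V) (creat : Creat X) where
    open Split s
    open Creation s creat
    private module Swapped = Creation (split-swap s) creat

    -- Swapping U back in for V undoes the exchange, which transfers maximality.
    exchange-max : ∀ {L a} → MaxCF L → a ∈ L → a ∈ U → MaxCF (exchange U V L)
    exchange-max {L} (cf , max) a∈L a∈U = exchange-cf cf a∈L a∈U , max′
      where
      max′ : ∀ L″ → CreationFree L″ → exchange U V L ⊆ L″ → L″ ⊆ exchange U V L
      max′ L″ cf″ L′⊆L″ {q} q∈L″ with q ∈? V
      ... | yes q∈V = ∈-exchange⁺ʳ U L q∈V
      ... | no q∉V  = ∈-exchange⁺ˡ V q∈L q∉U
        where
        v∈L″ = L′⊆L″ (∈-exchange⁺ʳ U L v∈V)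
        L⊆back : L ⊆ exchange V U L″
        L⊆back {y} y∈L with y ∈? U
        ... | yes y∈U = ∈-exchange⁺ʳ V L″ y∈U
        ... | no y∉U  = ∈-exchange⁺ˡ U (L′⊆L″ (∈-exchange⁺ˡ V y∈L y∉U)) (no-cross cf a∈L a∈U y∈L)
        q∈L : q ∈ L
        q∈L = max _ (Swapped.exchange-cf cf″ v∈L″ v∈V) L⊆back (∈-exchange⁺ˡ U q∈L″ q∉V)
        q∉U : q ∉ U
        q∉U q∈U = no-cross cf″ q∈L″ q∈U v∈L″ v∈V

    spanClass-split : SpanClass U
    spanClass-split = u , proj₁ cf-U u∈U , λ y → members y , classmates y
      where
      members : ∀ y → y ∈ U → y ∈ leaves P × SameSpan u y
      members y y∈U = proj₁ cf-U y∈U , λ L max → (λ u∈L → saturate max u∈L u∈U y∈U)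
                                             , (λ y∈L → saturate max y∈L y∈U u∈U)
      classmates : ∀ y → y ∈ leaves P × SameSpan u y → y ∈ U
      classmates y (y∈P , same) with y ∈? U
      ... | yes y∈U = y∈U
      ... | no y∉U with maximal-∋ y∈P
      ...   | M , max , y∈M with ∈-exchange⁻ U V M (proj₂ (same _ (exchange-max max (proj₂ (same M max) y∈M) u∈U))
                                                  (∈-exchange⁺ˡ V y∈M y∉U))
      ...     | inj₁ (_ , u∉U) = ⊥-elim (u∉U u∈U)
      ...     | inj₂ u∈V       = ⊥-elim (disjoint (u∈U , u∈V))

    ∣->>=-minus-exchange : ∀ {L a} → MaxCF L → a ∈ L → a ∈ U
      → ((P ∣ L) >>= λ Pi → minus Pi U) ≡ ((P ∣ exchange U V L) >>= λ Pi → minus Pi V)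
    ∣->>=-minus-exchange {L} max a∈L a∈U = begin
      ((P ∣ L) >>= λ Pi → minus Pi U)              ≡⟨ ∣->>=-minus P L U ⟩
      P ∣[ _∈? L ∖ U ]                             ≡⟨ ∣[]-cong (_∈? L ∖ U) (_∈? L′ ∖ V) P (λ _ → mk⇔ to from) ⟩
      P ∣[ _∈? L′ ∖ V ]                            ≡⟨ sym (∣->>=-minus P L′ V) ⟩
      ((P ∣ exchange U V L) >>= λ Pi → minus Pi V) ∎
      where
      open ≡-Reasoning
      L′ = exchange U V L
      to : ∀ {b} → b ∈ L × b ∉ U → b ∈ exchange U V L × b ∉ V
      to (b∈L , b∉U) = ∈-exchange⁺ˡ V b∈L b∉U , no-cross (proj₁ max) a∈L a∈U b∈L
      from : ∀ {b} → b ∈ exchange U V L × b ∉ V → b ∈ L × b ∉ U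
      from (b∈L′ , b∉V) = [ id , ⊥-elim ∘ b∉V ]′ (∈-exchange⁻ U V L b∈L′)

  module _ {X U V} (s : Split X U V) (¬creat : ¬ Creat X) where
    open Split s

    -- Without a creation at X every pair across U and V is orthologous.
    saturate-across : ∀ {L a} → MaxCF L → a ∈ L → a ∈ U → V ⊆ L
    saturate-across (cf , max) a∈L a∈U = MaxCF-absorbs (cf , max)
      (CreationFree-++-within X⊑P cf id a∈L (U⊆X a∈U) cf-V V⊆X inside)
      where
      inside : ∀ {y t} → y ∈ _ → y ∈ leaves X → t ∈ V → y ≢ t → Orthologs y t
      inside y∈L y∈X t∈V y≢t with cover y∈X
      ... | inj₁ y∈U = λ z lca → ¬creat ∘ subst Creat (lca-unique uP (here refl) lca (lca-UV y∈U t∈V))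
      ... | inj₂ y∈V = proj₂ cf-V _ _ y∈V t∈V y≢t

  NoCreation : Tree → Set
  NoCreation t = ∀ {w} → w ⊑ t → ¬ Creat w

  lowest-creation : ∀ t → NoCreation t
    ⊎ ∃[ l ] ∃[ r ] (node l r ⊑ t × Creat (node l r) × NoCreation l × NoCreation r)
  lowest-creation (leaf _) = inj₁ λ { here () }
  lowest-creation (node l r) with lowest-creation l | lowest-creation r
  ... | inj₂ (l′ , r′ , X⊑l , rest) | _ = inj₂ (l′ , r′ , inl X⊑l , rest)
  ... | inj₁ _ | inj₂ (l′ , r′ , X⊑r , rest) = inj₂ (l′ , r′ , inr X⊑r , rest)
  ... | inj₁ none-l | inj₁ none-r with creat? (node l r)
  ...   | yes creat = inj₂ (l , r , here , creat , none-l , none-r)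
  ...   | no ¬creat = inj₁ λ { here → ¬creat ; (inl w⊑l) → none-l w⊑l ; (inr w⊑r) → none-r w⊑r }

  NoCreation-cf : ∀ {t} → t ⊑ P → NoCreation t → CreationFree (leaves t)
  NoCreation-cf t⊑P none = ⊑-leaves t⊑P , λ a b a∈t b∈t _ z lca →
    none (lca-⊑ uP t⊑P (here refl) (λ { (here refl) → a∈t ; (there (here refl)) → b∈t }) lca)

  complete-leaves : ∀ {t} → t ⊑ P → IsComplete (leaves t)
  complete-leaves t⊑P = _ , t⊑P , ≡⇒≅M (∣-leaves uP t⊑P)

  -- The two children of a lowest creation node.
  goodPair-exists : ∃[ x ] (x ⊑ P × Creat x) → ∃[ U ] ∃[ V ] GoodPair U V
  goodPair-exists (x , x⊑P , creat-x) with lowest-creation P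
  ... | inj₁ none = ⊥-elim (none x⊑P creat-x)
  ... | inj₂ (l , r , X⊑P , creat , none-l , none-r) =
    leaves l , leaves r , spanClass-split s creat , spanClass-split (split-swap s) creat ,
    (λ (l⊆r , _) → disjoint (u∈U , l⊆r u∈U)) ,
    complete-leaves l⊑P , complete-leaves r⊑P , complete-leaves X⊑P
    where
    l⊑P = ⊑-trans (inl here) X⊑P
    r⊑P = ⊑-trans (inr here) X⊑P
    s : Split (node l r) (leaves l) (leaves r)
    s = split-children X⊑P id id id id
          (NoCreation-cf l⊑P none-l) (NoCreation-cf r⊑P none-r)
    open Split s using (disjoint; u∈U)

  goodPair-split : ∀ {U V} → GoodPair U V → ∃[ X ] Split X U V
  goodPair-split {U} {V} (class-U , class-V , distinct , (a′ , a′⊑P , a′≅U) , (b′ , b′⊑P , b′≅V) , (X , X⊑P , X≅U++V)) =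
    X , split (⊑-children (⊑-unique X⊑P uP) a′⊑X b′⊑X a′#b′ (Sum.map U⊆a′ V⊆b′ ∘ ∈-++⁻ U ∘ X⊆U++V))
    where
    a′⊆U = proj₁ (∣-complete-leaves P (spanClass-⊆ class-U) a′≅U)
    U⊆a′ = proj₂ (∣-complete-leaves P (spanClass-⊆ class-U) a′≅U)
    b′⊆V = proj₁ (∣-complete-leaves P (spanClass-⊆ class-V) b′≅V)
    V⊆b′ = proj₂ (∣-complete-leaves P (spanClass-⊆ class-V) b′≅V)
    X⊆U++V = proj₁ (∣-complete-leaves P ([ spanClass-⊆ class-U , spanClass-⊆ class-V ]′ ∘ ∈-++⁻ U) X≅U++V)
    U++V⊆X = proj₂ (∣-complete-leaves P ([ spanClass-⊆ class-U , spanClass-⊆ class-V ]′ ∘ ∈-++⁻ U) X≅U++V)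
    U#V : Disjoint U V
    U#V (a∈U , a∈V) = distinct (spanClass-overlap class-U class-V a∈U a∈V , spanClass-overlap class-V class-U a∈V a∈U)
    a′#b′ : Disjoint (leaves a′) (leaves b′)
    a′#b′ (c∈a′ , c∈b′) = U#V (a′⊆U c∈a′ , b′⊆V c∈b′)
    a′⊑X = ⊑-from-⊆ uP a′⊑P X⊑P (U++V⊆X ∘ ∈-++⁺ˡ ∘ a′⊆U)
    b′⊑X = ⊑-from-⊆ uP b′⊑P X⊑P (U++V⊆X ∘ ∈-++⁺ʳ U ∘ b′⊆V)
    split : X ≡ node a′ b′ ⊎ X ≡ node b′ a′ → Split X U V
    split (inj₁ eq) = subst (λ Y → Split Y U V) (sym eq)
      (split-children (subst (_⊑ P) eq X⊑P) U⊆a′ a′⊆U V⊆b′ b′⊆V (spanClass-cf class-U) (spanClass-cf class-V))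
    split (inj₂ eq) = subst (λ Y → Split Y U V) (sym eq) (split-swap
      (split-children (subst (_⊑ P) eq X⊑P) V⊆b′ b′⊆V U⊆a′ a′⊆U (spanClass-cf class-V) (spanClass-cf class-U)))

  -- Without a creation at X, U and V would be the same span class.
  split-creat : ∀ {X U V} → SpanClass U → SpanClass V → ¬ (U ⊆ V × V ⊆ U) → Split X U V → Creat X
  split-creat {X} class-U class-V distinct s with creat? X
  ... | yes creat = creat
  ... | no ¬creat =
    ⊥-elim (distinct (spanClass-overlap class-U class-V u∈U u∈V , spanClass-overlap class-V class-U u∈V u∈U))
    where
    open Split s
    same : SameSpan v u
    same L max = (λ v∈L → saturate-across (split-swap s) ¬creat max v∈L v∈V u∈U)
               , (λ u∈L → saturate-across s ¬creat max u∈L u∈U v∈V)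
    u∈V = spanClass-∈ class-V v∈V (proj₁ cf-U u∈U) same

  split-conclusions : ∀ {X U V} → SpanClass U → SpanClass V → Split X U V → Creat X → Conclusions U V
  split-conclusions {U = U} {V} class-U class-V s creat =
    (λ x lca → subst Creat (lca-unique uP (∈-++⁺ˡ u∈U) lca-U++V lca) creat) ,
    (λ { _ (inj₁ refl) L max inSpan → ≡⇒≅M (∣-spanClass class-U max inSpan)
       ; _ (inj₂ refl) L max inSpan → ≡⇒≅M (∣-spanClass class-V max inSpan) }) ,
    (λ L max (a , a∈U , a∈L) (b , b∈V , b∈L) → no-cross (proj₁ max) a∈L a∈U b∈L b∈V) ,
    (λ L max (a , a∈U , a∈L) → exchange U V L , exchange-max s creat max a∈L a∈U ,
       (v , v∈V , ∈-exchange⁺ʳ U L v∈V) , ≡⇒≅M (∣->>=-minus-exchange s creat max a∈L a∈U)) ,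
    (λ L′ max (b , b∈V , b∈L′) → exchange V U L′ , exchange-max (split-swap s) creat max b∈L′ b∈V ,
       (u , u∈U , ∈-exchange⁺ʳ V L′ u∈U) , ≡⇒≅M (sym (∣->>=-minus-exchange (split-swap s) creat max b∈L′ b∈V)))
    where
    open Split s
    open Creation s creat

  conclusions : ∀ {U V} → GoodPair U V → Conclusions U V
  conclusions good@(class-U , class-V , distinct , _) =
    let _ , s = goodPair-split good
    in split-conclusions class-U class-V s (split-creat class-U class-V distinct s)

lemma1 : (G : Tree) (gene : ℕ → ℕ) (P : Tree)
    → Unique (leaves G) → Unique (leaves P)
    → (∀ x → x ∈ leaves P → gene x ∈ leaves G)
    → let open Setting G gene P in
      ∃[ x ] (x ⊑ P × Creat x)
    → (∃[ Su ] ∃[ Sv ] GoodPair Su Sv)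
      × (∀ Su Sv → GoodPair Su Sv → Conclusions Su Sv)
lemma1 G gene P uG uP _ creation = goodPair-exists creation , λ _ _ → conclusions
  where open Reconciled G gene P uG uP
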